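{- Let $\mathcal L=\{R,G,X,Y\}$ and $S=\{RRX, RXX, RYY, GYX, GXX, YYX, XXX\}$. Then $\{R,G,Y\}$ is the only possible set of solutions for $Forb_c(S)$ to be a semi-free amalgamation class: $Forb_c(S)$ is a semi-free amalgamation class with set of solutions $\{R,G,Y\}$, and if $\mathcal L'\subsetneq\mathcal L$ is such that $Forb_c(S)$ is a semi-free amalgamation class with set of solutions $\mathcal L'$, then $\mathcal L'=\{R,G,Y\}$.
   Context: The relations of $\mathcal L$ are binary, symmetric and irreflexive; a structure is complete if any two distinct elements are related by exactly one relation. A triangle is a complete structure on three points, specified by the multiset of its edge relations. $Forb_c(S)$ is the class of finite complete structures embedding no triangle of $S$. $Forb_c(S)$ is a semi-free amalgamation class with set of solutions $\mathcal L'\subsetneq\mathcal L$ if it is an amalgamation class and for all $A,B,C\in Forb_c(S)$ and embeddings $f_1:B\to A$, $f_2:B\to C$ there are $D\in Forb_c(S)$ and embeddings $g_1:A\to D$, $g_2:C\to D$ with $g_1f_1(B)=g_2f_2(B)=g_1(A)\cap g_2(C)$ such that any relation holding between $a\in g_1(A)\setminus g_1f_1(B)$ and $c\in g_2(C)\setminus g_2f_2(B)$ belongs to $\mathcal L'$. -}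

module Defs where

open import Data.Nat using (ℕ)
open import Data.Fin using (Fin)
open import Data.Bool using (Bool; true; false)
open import Data.Product using (Σ; ∃; _×_; _,_)
open import Data.Sum using (_⊎_)
open import Data.List using (List; []; _∷_)
open import Data.List.Membership.Propositional using (_∈_)
open import Relation.Nullary using (¬_)
open import Relation.Binary.PropositionalEquality using (_≡_; _≢_)

data L : Set where
  R G X Y : L

RelSet : Set
RelSet = L → Bool

-- Any two distinct
-- elements i ≢ j are related by exactly one relation, namely rel i j;
-- relations are symmetric.  The value rel i i is irrelevant (irreflexivity):
-- it is never consulted by any definition below.
record Str : Set where
  field
    size : ℕ
    rel  : Fin size → Fin size → L
    sym  : ∀ i j → rel i j ≡ rel j i
open Str public

-- Embeddings: injective maps preserving (and, by completeness, reflecting)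
-- the relation on distinct pairs.
record Emb (A B : Str) : Set where
  field
    fun  : Fin (size A) → Fin (size B)
    inj  : ∀ i j → fun i ≡ fun j → i ≡ j
    pres : ∀ i j → i ≢ j → rel B (fun i) (fun j) ≡ rel A i j
open Emb public

-- A triangle: the multiset of its three edge relations, given by a representative triple.
Triangle : Set
Triangle = L × L × L

-- A embeds the triangle (x , y , z): there are three distinct points with
-- these edge labels (quantifying over all orderings of the points covers all
-- orderings of the multiset).
EmbedsTri : Str → Triangle → Set
EmbedsTri A (x , y , z) =
  Σ (Fin (size A)) λ i → Σ (Fin (size A)) λ j → Σ (Fin (size A)) λ k →
    i ≢ j × j ≢ k × i ≢ k ×
    rel A i j ≡ x × rel A j k ≡ y × rel A i k ≡ z

Forbc : List Triangle → Str → Set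
Forbc S A = ∀ t → t ∈ S → ¬ EmbedsTri A t

-- Amalgamation (Fraïssé) class of finite structures: hereditary (which,
-- with Fin-carriers, includes closure under isomorphism), joint embedding
-- property and amalgamation property.
record IsAmalgamationClass (K : Str → Set) : Set₁ where
  field
    hereditary : ∀ A B → Emb A B → K B → K A
    jep : ∀ A B → K A → K B →
          Σ Str λ D → K D × Emb A D × Emb B D
    ap  : ∀ A B C → K A → K B → K C → (f₁ : Emb B A) (f₂ : Emb B C) →
          Σ Str λ D → K D × Σ (Emb A D) λ g₁ → Σ (Emb C D) λ g₂ →
            ∀ b → fun g₁ (fun f₁ b) ≡ fun g₂ (fun f₂ b)

IsSemiFree : (K : Str → Set) → RelSet → Set₁
IsSemiFree K L' =
  (Σ L λ l → L' l ≡ false) ×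
  IsAmalgamationClass K ×
  (∀ A B C → K A → K B → K C → (f₁ : Emb B A) (f₂ : Emb B C) →
    Σ Str λ D → K D × Σ (Emb A D) λ g₁ → Σ (Emb C D) λ g₂ →
      (∀ b → fun g₁ (fun f₁ b) ≡ fun g₂ (fun f₂ b)) ×
      (∀ a c → fun g₁ a ≡ fun g₂ c →
         Σ (Fin (size B)) λ b → fun g₁ (fun f₁ b) ≡ fun g₁ a) ×
      (∀ a c → ¬ (Σ (Fin (size B)) λ b → fun f₁ b ≡ a) →
               ¬ (Σ (Fin (size B)) λ b → fun f₂ b ≡ c) →
               L' (rel D (fun g₁ a) (fun g₂ c)) ≡ true))

S : List Triangle
S = (R , R , X) ∷ (R , X , X) ∷ (R , Y , Y) ∷ (G , Y , X) ∷
    (G , X , X) ∷ (Y , Y , X) ∷ (X , X , X) ∷ []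

RGY : RelSet
RGY R = true
RGY G = true
RGY X = false
RGY Y = true

module Submission where

-- Given A ← B → C, the amalgam D consists of A together with the
-- new points of C.  A new point a of A and a new point c of C are joined by
-- Y if some b ∈ B sees both by X, otherwise by R if some b sees them by X
-- and Y, otherwise by G; this rule only depends on the profiles of a and c
-- (their labels towards B).  Every triangle of D lies in the copy of A, in
-- the copy of C, or contains a new point of each side; the last kind is
-- handled by finitely many facts about labels, decided by evaluation.
--
-- Amalgamating two one-point extensions of a small structure
-- over it forces the label between the two new points; three such problems
-- force G, R and Y to be solutions, and X is excluded because L' ≠ L.

open import Defs
open import Data.Nat using (ℕ; zero; suc)
open import Data.Fin using (Fin; zero; suc; splitAt; join)
open import Data.Fin.Properties using (_≟_; any?; suc-injective; splitAt-join; join-splitAt)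
open import Data.Product using (Σ; ∃; _×_; _,_; proj₁; proj₂)
open import Data.Product.Properties using (≡-dec)
open import Data.Sum using (_⊎_; inj₁; inj₂)
open import Data.Sum.Properties using (inj₁-injective; inj₂-injective)
open import Data.Unit using (⊤; tt)
open import Data.Bool using (true; false)
open import Data.Empty using (⊥-elim)
open import Data.List using (List; []; _∷_)
open import Data.List.Relation.Unary.Any as Any using (Any; here; there)
open import Data.List.Relation.Unary.All using (All; []; _∷_; lookupAny)
open import Data.List.Membership.Propositional using (_∈_)
open import Function using (_∘_)
open import Relation.Nullary using (¬_; Dec; yes; no; ¬?; contradiction)
open import Relation.Nullary.Decidable using (from-yes; map′; _×-dec_; _⊎-dec_; _→-dec_)
open import Relation.Unary using (Decidable)
open import Relation.Binary.Definitions using (DecidableEquality)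
open import Relation.Binary.PropositionalEquality
  using (_≡_; _≢_; refl; trans; cong; cong₂; subst; ≢-sym; module ≡-Reasoning)
  renaming (sym to ≡-sym)

_≟ℓ_ : DecidableEquality L
R ≟ℓ R = yes refl
R ≟ℓ G = no λ ()
R ≟ℓ X = no λ ()
R ≟ℓ Y = no λ ()
G ≟ℓ R = no λ ()
G ≟ℓ G = yes refl
G ≟ℓ X = no λ ()
G ≟ℓ Y = no λ ()
X ≟ℓ R = no λ ()
X ≟ℓ G = no λ ()
X ≟ℓ X = yes refl
X ≟ℓ Y = no λ ()
Y ≟ℓ R = no λ ()
Y ≟ℓ G = no λ ()
Y ≟ℓ X = no λ ()
Y ≟ℓ Y = yes refl

_≟△_ : DecidableEquality Triangle
_≟△_ = ≡-dec _≟ℓ_ (≡-dec _≟ℓ_ _≟ℓ_)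

open import Data.List.Membership.DecPropositional _≟△_ using (_∈?_)

-- Quantification over the four labels is decidable; together with the
-- decision procedures below this lets us decide finite facts about labels.
every? : {P : L → Set} → (∀ x → Dec (P x)) → Dec (∀ x → P x)
every? P? with P? R | P? G | P? X | P? Y
... | yes r | yes g | yes x | yes y = yes λ { R → r ; G → g ; X → x ; Y → y }
... | no ¬r | _     | _     | _     = no λ h → ¬r (h R)
... | _     | no ¬g | _     | _     = no λ h → ¬g (h G)
... | _     | _     | no ¬x | _     = no λ h → ¬x (h X)
... | _     | _     | _     | no ¬y = no λ h → ¬y (h Y)

Distinct : {T : Set} → T → T → T → Set
Distinct x y z = x ≢ y × y ≢ z × x ≢ z

distinct-swap₁₂ : {T : Set} {x y z : T} → Distinct x y z → Distinct y x z
distinct-swap₁₂ (x≢y , y≢z , x≢z) = ≢-sym x≢y , x≢z , y≢z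

distinct-swap₂₃ : {T : Set} {x y z : T} → Distinct x y z → Distinct x z y
distinct-swap₂₃ (x≢y , y≢z , x≢z) = x≢z , ≢-sym y≢z , x≢y

distinct-map : {T U : Set} {g : T → U} → (∀ x y → g x ≡ g y → x ≡ y) →
               ∀ {x y z} → Distinct x y z → Distinct (g x) (g y) (g z)
distinct-map g-inj {x} {y} {z} (x≢y , y≢z , x≢z) =
  x≢y ∘ g-inj x y , y≢z ∘ g-inj y z , x≢z ∘ g-inj x z

distinct-reflect : {T U : Set} (g : T → U) → ∀ {x y z} → Distinct (g x) (g y) (g z) → Distinct x y z
distinct-reflect g (x≢y , y≢z , x≢z) = x≢y ∘ cong g , y≢z ∘ cong g , x≢z ∘ cong g

orderings : L → L → L → List Triangle
orderings x y z =
  (x , y , z) ∷ (x , z , y) ∷ (y , x , z) ∷ (y , z , x) ∷ (z , x , y) ∷ (z , y , x) ∷ []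

-- A triangle with edges x, y, z is allowed when no ordering of its edges is
-- in Ts.  (A record, so that Ts, x, y, z can be inferred from it.)
record Allowed (Ts : List Triangle) (x y z : L) : Set where
  constructor allowed
  field not-forbidden : ¬ Any (_∈ Ts) (orderings x y z)

Allowed-resp : ∀ {Ts x x' y y' z z'} → x ≡ x' → y ≡ y' → z ≡ z' →
               Allowed Ts x y z → Allowed Ts x' y' z'
Allowed-resp refl refl refl ok = ok

-- Allowedness depends only on the multiset of edges: it is invariant under
-- transpositions, since these permute the list of orderings.
allowed-swap₁₂ : ∀ {Ts x y z} → Allowed Ts x y z → Allowed Ts y x z
allowed-swap₁₂ (allowed ok) = allowed (ok ∘ reorder)
  where
  reorder : ∀ {P : Triangle → Set} {x y z} → Any P (orderings y x z) → Any P (orderings x y z)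
  reorder (here p)                                 = there (there (here p))
  reorder (there (here p))                         = there (there (there (here p)))
  reorder (there (there (here p)))                 = here p
  reorder (there (there (there (here p))))         = there (here p)
  reorder (there (there (there (there (here p))))) = there (there (there (there (there (here p)))))
  reorder (there (there (there (there (there (here p)))))) = there (there (there (there (here p))))

allowed-swap₂₃ : ∀ {Ts x y z} → Allowed Ts x y z → Allowed Ts x z y
allowed-swap₂₃ (allowed ok) = allowed (ok ∘ reorder)
  where
  reorder : ∀ {P : Triangle → Set} {x y z} → Any P (orderings x z y) → Any P (orderings x y z)
  reorder (here p)                                 = there (here p)
  reorder (there (here p))                         = here p
  reorder (there (there (here p)))                 = there (there (there (there (here p))))
  reorder (there (there (there (here p))))         = there (there (there (there (there (here p)))))
  reorder (there (there (there (there (here p))))) = there (there (here p))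
  reorder (there (there (there (there (there (here p)))))) = there (there (there (here p)))

allowed-swap₁₃ : ∀ {Ts x y z} → Allowed Ts x y z → Allowed Ts z y x
allowed-swap₁₃ = allowed-swap₁₂ ∘ allowed-swap₂₃ ∘ allowed-swap₁₂

Avoids : List Triangle → Str → Set
Avoids Ts A = ∀ i j k → Distinct i j k → Allowed Ts (rel A i j) (rel A j k) (rel A i k)

embeds-orderings : (A : Str) {i j k : Fin (size A)} → Distinct i j k →
                   All (EmbedsTri A) (orderings (rel A i j) (rel A j k) (rel A i k))
embeds-orderings A {i} {j} {k} (i≢j , j≢k , i≢k) =
    (i , j , k , i≢j , j≢k , i≢k , refl , refl , refl)
  ∷ (j , i , k , ≢-sym i≢j , i≢k , j≢k , s j i , refl , refl)
  ∷ (k , j , i , ≢-sym j≢k , ≢-sym i≢j , ≢-sym i≢k , s k j , s j i , s k i)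
  ∷ (j , k , i , j≢k , ≢-sym i≢k , ≢-sym i≢j , refl , s k i , s j i)
  ∷ (k , i , j , ≢-sym i≢k , i≢j , ≢-sym j≢k , s k i , refl , s k j)
  ∷ (i , k , j , i≢k , ≢-sym j≢k , i≢j , refl , s k j , refl)
  ∷ []
  where s = Str.sym A

forbc⇒avoids : ∀ {Ts} A → Forbc Ts A → Avoids Ts A
forbc⇒avoids A forbc i j k distinct = allowed λ forbidden →
  let (embeds , t∈Ts) = lookupAny (embeds-orderings A distinct) forbidden
  in forbc _ t∈Ts embeds

avoids⇒forbc : ∀ {Ts} A → Avoids Ts A → Forbc Ts A
avoids⇒forbc A avoids (x , y , z) t∈Ts (i , j , k , i≢j , j≢k , i≢k , refl , refl , refl) =
  Allowed.not-forbidden (avoids i j k (i≢j , j≢k , i≢k)) (here t∈Ts)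

embedsTri-map : ∀ {A B} (f : Emb A B) t → EmbedsTri A t → EmbedsTri B t
embedsTri-map f (x , y , z) (i , j , k , i≢j , j≢k , i≢k , eij , ejk , eik) =
  fun f i , fun f j , fun f k ,
  i≢j ∘ inj f i j , j≢k ∘ inj f j k , i≢k ∘ inj f i k ,
  trans (pres f i j i≢j) eij , trans (pres f j k j≢k) ejk , trans (pres f i k i≢k) eik

forbc-hereditary : ∀ {Ts A B} → Emb A B → Forbc Ts B → Forbc Ts A
forbc-hereditary f forbc t t∈Ts = forbc t t∈Ts ∘ embedsTri-map f t

InImage : ∀ {A B} → Emb B A → Fin (size A) → Set
InImage {B = B} f a = Σ (Fin (size B)) λ b → fun f b ≡ a

data Side {A B : Str} (f : Emb B A) : Fin (size A) → Set where
  old : ∀ b → Side f (fun f b)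
  new : ∀ a → ¬ InImage f a → Side f a

side : ∀ {A B} (f : Emb B A) a → Side f a
side f a with any? (λ b → fun f b ≟ a)
... | yes (b , refl) = old b
... | no ¬old        = new a ¬old

-- A profile of labels towards B (the edges from a new point to the points
-- of B) is compatible if it completes no edge of B to a forbidden triangle.
Compatible : List Triangle → (B : Str) → (Fin (size B) → L) → Set
Compatible Ts B ℓ = ∀ b b' → b ≢ b' → Allowed Ts (ℓ b) (rel B b b') (ℓ b')

profile-compatible : ∀ {Ts A B} → Forbc Ts A → (f : Emb B A) →
                     ∀ a → ¬ InImage f a → Compatible Ts B (λ b → rel A a (fun f b))
profile-compatible {A = A} forbc f a a-new b b' b≢b' =
  subst (λ e → Allowed _ (rel A a (fun f b)) e (rel A a (fun f b'))) (pres f b b' b≢b')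
    (forbc⇒avoids A forbc a (fun f b) (fun f b')
      ((λ e → a-new (b , ≡-sym e)) , b≢b' ∘ inj f b b' , (λ e → a-new (b' , ≡-sym e))))

∅ : Str
∅ = record { size = 0 ; rel = λ () ; sym = λ () }

∅-emb : ∀ A → Emb ∅ A
∅-emb A = record { fun = λ () ; inj = λ () ; pres = λ () }

extend-rel : (B : Str) → (Fin (size B) → L) → Fin (suc (size B)) → Fin (suc (size B)) → L
extend-rel B ℓ zero    zero     = R
extend-rel B ℓ zero    (suc b)  = ℓ b
extend-rel B ℓ (suc b) zero     = ℓ b
extend-rel B ℓ (suc b) (suc b') = rel B b b'

extend : (B : Str) → (Fin (size B) → L) → Str
extend B ℓ = record { size = suc (size B) ; rel = extend-rel B ℓ ; sym = symmetric }
  where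
  symmetric : ∀ i j → extend-rel B ℓ i j ≡ extend-rel B ℓ j i
  symmetric zero    zero     = refl
  symmetric zero    (suc b)  = refl
  symmetric (suc b) zero     = refl
  symmetric (suc b) (suc b') = Str.sym B b b'

extend-emb : ∀ {B ℓ} → Emb B (extend B ℓ)
extend-emb = record { fun = suc ; inj = λ _ _ → suc-injective ; pres = λ _ _ _ → refl }

extend-forbc : ∀ {Ts} B ℓ → Forbc Ts B → Compatible Ts B ℓ → Forbc Ts (extend B ℓ)
extend-forbc {Ts} B ℓ forbc compatible = avoids⇒forbc (extend B ℓ) triangles
  where
  triangles : Avoids Ts (extend B ℓ)
  triangles zero    zero     _        (i≢j , _)       = ⊥-elim (i≢j refl)
  triangles zero    (suc b)  zero     (_ , _ , i≢k)   = ⊥-elim (i≢k refl)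
  triangles zero    (suc b)  (suc b') (_ , j≢k , _)   = compatible b b' (j≢k ∘ cong suc)
  triangles (suc b) zero     zero     (_ , j≢k , _)   = ⊥-elim (j≢k refl)
  triangles (suc b) zero     (suc b') (_ , _ , i≢k)   =
    allowed-swap₂₃ (compatible b b' (i≢k ∘ cong suc))
  triangles (suc b) (suc b') zero     (i≢j , _)       =
    subst (λ e → Allowed Ts e (ℓ b') (ℓ b)) (Str.sym B b' b)
      (allowed-swap₁₂ (compatible b' b (i≢j ∘ cong suc ∘ ≡-sym)))
  triangles (suc b) (suc b') (suc b'') distinct =
    forbc⇒avoids B forbc b b' b'' (distinct-reflect suc distinct)

-- One point, an edge labelled x, and a triangle: the edge x between points
-- 1 and 2, and the new point 0 joined to them by y and z.
point : Str
point = extend ∅ (λ ())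

edge : L → Str
edge x = extend point (λ _ → x)

sides : L → L → Fin 2 → L
sides y z zero    = y
sides y z (suc _) = z

triangle : L → L → L → Str
triangle x y z = extend (edge x) (sides y z)

point-forbc : ∀ {Ts} → Forbc Ts point
point-forbc = extend-forbc ∅ (λ ()) (avoids⇒forbc ∅ λ ()) (λ ())

edge-forbc : ∀ {Ts} x → Forbc Ts (edge x)
edge-forbc x = extend-forbc point (λ _ → x) point-forbc λ { zero zero 0≢0 → ⊥-elim (0≢0 refl) }

triangle-forbc : ∀ {Ts} x y z → Allowed Ts y x z → Forbc Ts (triangle x y z)
triangle-forbc x y z ok = extend-forbc (edge x) (sides y z) (edge-forbc x) λ
  { zero          zero          0≢0 → ⊥-elim (0≢0 refl)
  ; zero          (suc zero)    _   → ok
  ; (suc zero)    zero          _   → allowed-swap₁₃ ok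
  ; (suc zero)    (suc zero)    1≢1 → ⊥-elim (1≢1 refl) }

record Enumeration {T : Set} (P : T → Set) : Set where
  field
    count          : ℕ
    elem           : Fin count → T
    elem-injective : ∀ i j → elem i ≡ elem j → i ≡ j
    elem-sat       : ∀ i → P (elem i)
    index          : ∀ x → P x → Fin count
    elem-index     : ∀ x (p : P x) → elem (index x p) ≡ x

  same-element : ∀ {i j x y} → elem i ≡ x → elem j ≡ y → i ≡ j → x ≡ y
  same-element ex ey refl = trans (≡-sym ex) ey

  same-index : ∀ {i j x} → elem i ≡ x → elem j ≡ x → i ≡ j
  same-index ex ey = elem-injective _ _ (trans ex (≡-sym ey))

enumeration-cons : ∀ {m} {P : Fin (suc m) → Set} → P zero → Enumeration (P ∘ suc) → Enumeration P
enumeration-cons {P = P} p₀ E = record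
  { count = suc count ; elem = elem′ ; elem-injective = elem′-injective
  ; elem-sat = elem′-sat ; index = index′ ; elem-index = elem′-index′ }
  where
  open Enumeration E
  elem′ : Fin (suc count) → Fin _
  elem′ zero    = zero
  elem′ (suc i) = suc (elem i)
  elem′-injective : ∀ i j → elem′ i ≡ elem′ j → i ≡ j
  elem′-injective zero    zero    _ = refl
  elem′-injective (suc i) (suc j) e = cong suc (elem-injective i j (suc-injective e))
  elem′-sat : ∀ i → P (elem′ i)
  elem′-sat zero    = p₀
  elem′-sat (suc i) = elem-sat i
  index′ : ∀ x → P x → Fin (suc count)
  index′ zero    _ = zero
  index′ (suc x) p = suc (index x p)
  elem′-index′ : ∀ x p → elem′ (index′ x p) ≡ x
  elem′-index′ zero    _ = refl
  elem′-index′ (suc x) p = cong suc (elem-index x p)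

enumeration-skip : ∀ {m} {P : Fin (suc m) → Set} → ¬ P zero → Enumeration (P ∘ suc) → Enumeration P
enumeration-skip {P = P} ¬p₀ E = record
  { count = count ; elem = suc ∘ elem ; elem-injective = λ i j → elem-injective i j ∘ suc-injective
  ; elem-sat = elem-sat ; index = index′ ; elem-index = elem-index′ }
  where
  open Enumeration E
  index′ : ∀ x → P x → Fin count
  index′ zero    p = contradiction p ¬p₀
  index′ (suc x) p = index x p
  elem-index′ : ∀ x p → suc (elem (index′ x p)) ≡ x
  elem-index′ zero    p = contradiction p ¬p₀
  elem-index′ (suc x) p = cong suc (elem-index x p)

enumerate-Fin : ∀ m {P : Fin m → Set} → Decidable P → Enumeration P
enumerate-Fin zero    P? = record
  { count = 0 ; elem = λ () ; elem-injective = λ () ; elem-sat = λ () ; index = λ () ; elem-index = λ () }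
enumerate-Fin (suc m) P? with P? zero
... | yes p₀  = enumeration-cons p₀  (enumerate-Fin m (P? ∘ suc))
... | no  ¬p₀ = enumeration-skip ¬p₀ (enumerate-Fin m (P? ∘ suc))

enumerate-via : ∀ {T : Set} {m} (to : T → Fin m) (from : Fin m → T) →
                (∀ x → from (to x) ≡ x) → (∀ i → to (from i) ≡ i) →
                {P : T → Set} → Decidable P → Enumeration P
enumerate-via {m = m} to from from-to to-from {P} P? = record
  { count = count ; elem = from ∘ elem
  ; elem-injective = λ i j e → elem-injective i j (trans (≡-sym (to-from _)) (trans (cong to e) (to-from _)))
  ; elem-sat = elem-sat
  ; index = λ x p → index (to x) (subst P (≡-sym (from-to x)) p)
  ; elem-index = λ x p → trans (cong from (elem-index (to x) _)) (from-to x) }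
  where open Enumeration (enumerate-Fin m (P? ∘ from))

-- From here on the forbidden triangles are S.  The facts below about
-- labels are all verified by deciding them over the four labels.
Allowedₛ : L → L → L → Set
Allowedₛ = Allowed S

allowed? : ∀ x y z → Dec (Allowedₛ x y z)
allowed? x y z = map′ allowed Allowed.not-forbidden (¬? (Any.any? (_∈? S) (orderings x y z)))

data XX : L → L → Set where
  X-X : XX X X

data XY : L → L → Set where
  X-Y : XY X Y
  Y-X : XY Y X

XX? : ∀ p q → Dec (XX p q)
XX? p q = map′ (λ { (refl , refl) → X-X }) (λ { X-X → refl , refl }) (p ≟ℓ X ×-dec q ≟ℓ X)

XY? : ∀ p q → Dec (XY p q)
XY? p q = map′ (λ { (inj₁ (refl , refl)) → X-Y ; (inj₂ (refl , refl)) → Y-X })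
               (λ { X-Y → inj₁ (refl , refl) ; Y-X → inj₂ (refl , refl) })
               ((p ≟ℓ X ×-dec q ≟ℓ Y) ⊎-dec (p ≟ℓ Y ×-dec q ≟ℓ X))

XX-swap : ∀ {p q} → XX p q → XX q p
XX-swap X-X = X-X

XY-swap : ∀ {p q} → XY p q → XY q p
XY-swap X-Y = Y-X
XY-swap Y-X = X-Y

-- The triangle (a, b, c) with a, c new and b old, for the three labels the rule can choose.
XX-allows-Y : ∀ p q → XX p q → Allowedₛ p q Y
XX-allows-Y = from-yes (every? λ p → every? λ q → XX? p q →-dec allowed? p q Y)

XY-allows-R : ∀ p q → XY p q → Allowedₛ p q R
XY-allows-R = from-yes (every? λ p → every? λ q → XY? p q →-dec allowed? p q R)

neither-allows-G : ∀ p q → ¬ XX p q → ¬ XY p q → Allowedₛ p q G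
neither-allows-G = from-yes (every? λ p → every? λ q →
  ¬? (XX? p q) →-dec ¬? (XY? p q) →-dec allowed? p q G)

-- A witness b₀ for Y or R keeps the triangle (a, b, c) allowed for every other
-- old point b, given the triangles (a, b₀, b) in A and (c, b₀, b) in C.
XX-propagates-Y : ∀ p₀ q₀ e p q → XX p₀ q₀ → Allowedₛ p₀ e p → Allowedₛ q₀ e q →
                  Allowedₛ p q Y
XX-propagates-Y = from-yes (every? λ p₀ → every? λ q₀ → every? λ e → every? λ p → every? λ q →
  XX? p₀ q₀ →-dec allowed? p₀ e p →-dec allowed? q₀ e q →-dec allowed? p q Y)

XY-propagates-R : ∀ p₀ q₀ e p q → XY p₀ q₀ → Allowedₛ p₀ e p → Allowedₛ q₀ e q →
                  ¬ XX p q → Allowedₛ p q R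
XY-propagates-R = from-yes (every? λ p₀ → every? λ q₀ → every? λ e → every? λ p → every? λ q →
  XY? p₀ q₀ →-dec allowed? p₀ e p →-dec allowed? q₀ e q →-dec ¬? (XX? p q) →-dec allowed? p q R)

-- The triangle (a, a', c) with all three points new: a witness b₀ for the
-- label of ac, through the triangles (a, a', b₀) and (a', b₀, c), allows it.
XX-closes-Y : ∀ e s p q r → XX p q → Allowedₛ e s p → Allowedₛ s q r → r ≢ X → Allowedₛ e r Y
XX-closes-Y = from-yes (every? λ e → every? λ s → every? λ p → every? λ q → every? λ r →
  XX? p q →-dec allowed? e s p →-dec allowed? s q r →-dec ¬? (r ≟ℓ X) →-dec allowed? e r Y)

XY-closes-R : ∀ e s p q r → XY p q → Allowedₛ e s p → Allowedₛ s q r → r ≢ X → Allowedₛ e r R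
XY-closes-R = from-yes (every? λ e → every? λ s → every? λ p → every? λ q → every? λ r →
  XY? p q →-dec allowed? e s p →-dec allowed? s q r →-dec ¬? (r ≟ℓ X) →-dec allowed? e r R)

G-G-allowed : ∀ e → Allowedₛ e G G
G-G-allowed = from-yes (every? λ e → allowed? e G G)

-- The labels forced in the three amalgamation problems of the uniqueness part.
only-G : ∀ l → Allowedₛ R X l → Allowedₛ R Y l → l ≡ G
only-G = from-yes (every? λ l → allowed? R X l →-dec allowed? R Y l →-dec l ≟ℓ G)

only-R : ∀ l → Allowedₛ X Y l → Allowedₛ G X l → l ≡ R
only-R = from-yes (every? λ l → allowed? X Y l →-dec allowed? G X l →-dec l ≟ℓ R)

only-Y : ∀ l → Allowedₛ X X l → l ≡ Y
only-Y = from-yes (every? λ l → allowed? X X l →-dec l ≟ℓ Y)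

module Rule (B : Str) where

  Profile : Set
  Profile = Fin (size B) → L

  NoXX : Profile → Profile → Set
  NoXX p q = ∀ b → ¬ XX (p b) (q b)

  SomeXX SomeXY : Profile → Profile → Set
  SomeXX p q = ∃ λ b → XX (p b) (q b)
  SomeXY p q = ∃ λ b → XY (p b) (q b)

  someXX? : ∀ p q → Dec (SomeXX p q)
  someXX? p q = any? λ b → XX? (p b) (q b)

  someXY? : ∀ p q → Dec (SomeXY p q)
  someXY? p q = any? λ b → XY? (p b) (q b)

  choose : ∀ {p q} → Dec (SomeXX p q) → Dec (SomeXY p q) → L
  choose (yes _) _       = Y
  choose (no _)  (yes _) = R
  choose (no _)  (no _)  = G

  rule : Profile → Profile → L
  rule p q = choose (someXX? p q) (someXY? p q)

  data RuleView (p q : Profile) : L → Set where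
    some-XX : ∀ b → XX (p b) (q b) → RuleView p q Y
    some-XY : ∀ b → XY (p b) (q b) → NoXX p q → RuleView p q R
    neither : NoXX p q → (∀ b → ¬ XY (p b) (q b)) → RuleView p q G

  choose-view : ∀ {p q} (xx? : Dec (SomeXX p q)) (xy? : Dec (SomeXY p q)) → RuleView p q (choose xx? xy?)
  choose-view (yes (b , xx)) _            = some-XX b xx
  choose-view (no ¬xx)       (yes (b , xy)) = some-XY b xy (λ b xx → ¬xx (b , xx))
  choose-view (no ¬xx)       (no ¬xy)       = neither (λ b xx → ¬xx (b , xx)) (λ b xy → ¬xy (b , xy))

  rule-view : ∀ p q → RuleView p q (rule p q)
  rule-view p q = choose-view (someXX? p q) (someXY? p q)

  view-swap : ∀ {p q ℓ} → RuleView p q ℓ → RuleView q p ℓ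
  view-swap (some-XX b xx)      = some-XX b (XX-swap xx)
  view-swap (some-XY b xy noXX) = some-XY b (XY-swap xy) (λ b → noXX b ∘ XX-swap)
  view-swap (neither noXX noXY) = neither (λ b → noXX b ∘ XX-swap) (λ b → noXY b ∘ XY-swap)

  view-RGY : ∀ {p q ℓ} → RuleView p q ℓ → RGY ℓ ≡ true
  view-RGY (some-XX _ _)   = refl
  view-RGY (some-XY _ _ _) = refl
  view-RGY (neither _ _)   = refl

  view-not-X : ∀ {p q ℓ} → RuleView p q ℓ → ℓ ≢ X
  view-not-X (some-XX _ _)   ()
  view-not-X (some-XY _ _ _) ()
  view-not-X (neither _ _)   ()

  view-allowed : ∀ {p q ℓ} → Compatible S B p → Compatible S B q →
                 RuleView p q ℓ → ∀ b → Allowedₛ (p b) (q b) ℓ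
  view-allowed {p} {q} cp cq (some-XX b₀ xx) b with b₀ ≟ b
  ... | yes refl = XX-allows-Y (p b) (q b) xx
  ... | no b₀≢b  = XX-propagates-Y _ _ _ _ _ xx (cp b₀ b b₀≢b) (cq b₀ b b₀≢b)
  view-allowed {p} {q} cp cq (some-XY b₀ xy noXX) b with b₀ ≟ b
  ... | yes refl = XY-allows-R (p b) (q b) xy
  ... | no b₀≢b  = XY-propagates-R _ _ _ _ _ xy (cp b₀ b b₀≢b) (cq b₀ b b₀≢b) (noXX b)
  view-allowed {p} {q} cp cq (neither noXX noXY) b = neither-allows-G (p b) (q b) (noXX b) (noXY b)

  -- Triangles of three new points: u, u' on one side joined by e, and v on
  -- the other, given that the triangles (u, u', b) are allowed.
  view-allowed₂ : ∀ {e u u' v ℓ ℓ'} → Compatible S B u → Compatible S B u' → Compatible S B v →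
                  (∀ b → Allowedₛ e (u' b) (u b)) →
                  RuleView u v ℓ → RuleView u' v ℓ' → Allowedₛ e ℓ' ℓ
  view-allowed₂ cu cu' cv h (some-XX b₀ xx) view' =
    XX-closes-Y _ _ _ _ _ xx (h b₀) (view-allowed cu' cv view' b₀) (view-not-X view')
  view-allowed₂ cu cu' cv h (some-XY b₀ xy _) view' =
    XY-closes-R _ _ _ _ _ xy (h b₀) (view-allowed cu' cv view' b₀) (view-not-X view')
  view-allowed₂ cu cu' cv h (neither _ _) (neither _ _) = G-G-allowed _
  view-allowed₂ cu cu' cv h view@(neither _ _) (some-XX b₀ xx) = allowed-swap₂₃
    (XX-closes-Y _ _ _ _ _ xx (allowed-swap₂₃ (h b₀)) (view-allowed cu cv view b₀) λ ())
  view-allowed₂ cu cu' cv h view@(neither _ _) (some-XY b₀ xy _) = allowed-swap₂₃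
    (XY-closes-R _ _ _ _ _ xy (allowed-swap₂₃ (h b₀)) (view-allowed cu cv view b₀) λ ())

SemiFreeAmalgam : (Str → Set) → RelSet → ∀ {A B C} → Emb B A → Emb B C → Set
SemiFreeAmalgam K L' {A} {B} {C} f₁ f₂ =
  Σ Str λ D → K D × Σ (Emb A D) λ g₁ → Σ (Emb C D) λ g₂ →
    (∀ b → fun g₁ (fun f₁ b) ≡ fun g₂ (fun f₂ b)) ×
    (∀ a c → fun g₁ a ≡ fun g₂ c → Σ (Fin (size B)) λ b → fun g₁ (fun f₁ b) ≡ fun g₁ a) ×
    (∀ a c → ¬ InImage f₁ a → ¬ InImage f₂ c → L' (rel D (fun g₁ a) (fun g₂ c)) ≡ true)

module Amalgam {A B C : Str} (forbc-A : Forbc S A) (forbc-C : Forbc S C)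
               (f₁ : Emb B A) (f₂ : Emb B C) where
  open Rule B

  profileA : Fin (size A) → Profile
  profileA a b = rel A a (fun f₁ b)

  profileC : Fin (size C) → Profile
  profileC c b = rel C c (fun f₂ b)

  avoids-A : Avoids S A
  avoids-A = forbc⇒avoids A forbc-A

  avoids-C : Avoids S C
  avoids-C = forbc⇒avoids C forbc-C

  compatibleA : ∀ a → ¬ InImage f₁ a → Compatible S B (profileA a)
  compatibleA = profile-compatible forbc-A f₁

  compatibleC : ∀ c → ¬ InImage f₂ c → Compatible S B (profileC c)
  compatibleC = profile-compatible forbc-C f₂

  -- The points of the amalgam: all of A and the new points of C.
  Point : Set
  Point = Fin (size A) ⊎ Fin (size C)

  InD : Point → Set
  InD (inj₁ _) = ⊤
  InD (inj₂ c) = ¬ InImage f₂ c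

  crossFrom : ∀ {a} → Side f₁ a → Fin (size C) → L
  crossFrom (old b)   c = rel C (fun f₂ b) c
  crossFrom (new a _) c = rule (profileA a) (profileC c)

  cross : Fin (size A) → Fin (size C) → L
  cross a = crossFrom (side f₁ a)

  cross-old : ∀ b c → cross (fun f₁ b) c ≡ rel C (fun f₂ b) c
  cross-old b c = crossFrom-old (side f₁ (fun f₁ b)) refl
    where
    crossFrom-old : ∀ {a} (s : Side f₁ a) → fun f₁ b ≡ a → crossFrom s c ≡ rel C (fun f₂ b) c
    crossFrom-old (old b')   e = cong (λ b → rel C (fun f₂ b) c) (≡-sym (inj f₁ b b' e))
    crossFrom-old (new a na) e = contradiction (b , e) na

  cross-new : ∀ a c → ¬ InImage f₁ a → cross a c ≡ rule (profileA a) (profileC c)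
  cross-new a c na = crossFrom-new (side f₁ a)
    where
    crossFrom-new : (s : Side f₁ a) → crossFrom s c ≡ rule (profileA a) (profileC c)
    crossFrom-new (old b)   = contradiction (b , refl) na
    crossFrom-new (new a _) = refl

  relP : Point → Point → L
  relP (inj₁ a) (inj₁ a') = rel A a a'
  relP (inj₁ a) (inj₂ c)  = cross a c
  relP (inj₂ c) (inj₁ a)  = cross a c
  relP (inj₂ c) (inj₂ c') = rel C c c'

  relP-sym : ∀ x y → relP x y ≡ relP y x
  relP-sym (inj₁ a) (inj₁ a') = Str.sym A a a'
  relP-sym (inj₁ a) (inj₂ c)  = refl
  relP-sym (inj₂ c) (inj₁ a)  = refl
  relP-sym (inj₂ c) (inj₂ c') = Str.sym C c c'

  -- Where a point of C lands: an old point is identified with its copy in A.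
  place : ∀ {c} → Side f₂ c → Point
  place (old b)   = inj₁ (fun f₁ b)
  place (new c _) = inj₂ c

  place-in-D : ∀ {c} (s : Side f₂ c) → InD (place s)
  place-in-D (old b)    = tt
  place-in-D (new c nc) = nc

  place-determined : ∀ {c c'} (s : Side f₂ c) (s' : Side f₂ c') → c ≡ c' → place s ≡ place s'
  place-determined (old b)    (old b')    e = cong (inj₁ ∘ fun f₁) (inj f₂ b b' e)
  place-determined (old b)    (new c nc)  e = contradiction (b , e) nc
  place-determined (new c nc) (old b)     e = contradiction (b , ≡-sym e) nc
  place-determined (new c _)  (new c' _)  e = cong inj₂ e

  place-injective : ∀ {c c'} (s : Side f₂ c) (s' : Side f₂ c') → place s ≡ place s' → c ≡ c'
  place-injective (old b)   (old b')   e = cong (fun f₂) (inj f₁ b b' (inj₁-injective e))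
  place-injective (new c _) (new c' _) e = inj₂-injective e

  place-rel : ∀ {c c'} (s : Side f₂ c) (s' : Side f₂ c') → c ≢ c' →
              relP (place s) (place s') ≡ rel C c c'
  place-rel (old b)   (old b')   c≢c' = trans (pres f₁ b b' b≢b') (≡-sym (pres f₂ b b' b≢b'))
    where b≢b' = c≢c' ∘ cong (fun f₂)
  place-rel (old b)   (new c _)  _    = cross-old b c
  place-rel (new c _) (old b)    _    = trans (cross-old b c) (Str.sym C (fun f₂ b) c)
  place-rel (new c _) (new c' _) _    = refl

  place-in-A : ∀ {a c} (s : Side f₂ c) → inj₁ a ≡ place s → InImage f₁ a
  place-in-A (old b) e = b , ≡-sym (inj₁-injective e)

  TriangleOK : Point → Point → Point → Set
  TriangleOK x y z = Allowedₛ (relP x y) (relP y z) (relP x z)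

  reorder₁₂ : ∀ {x y z} → Distinct x y z → (Distinct y x z → TriangleOK y x z) → TriangleOK x y z
  reorder₁₂ {x} {y} d check =
    allowed-swap₂₃ (Allowed-resp (relP-sym y x) refl refl (check (distinct-swap₁₂ d)))

  reorder₂₃ : ∀ {x y z} → Distinct x y z → (Distinct x z y → TriangleOK x z y) → TriangleOK x y z
  reorder₂₃ {y = y} {z} d check =
    allowed-swap₁₃ (Allowed-resp refl (relP-sym z y) refl (check (distinct-swap₂₃ d)))

  in-A-triangle : ∀ {a a' a''} → Distinct {Point} (inj₁ a) (inj₁ a') (inj₁ a'') →
                  TriangleOK (inj₁ a) (inj₁ a') (inj₁ a'')
  in-A-triangle d = avoids-A _ _ _ (distinct-reflect inj₁ d)

  in-C-triangle : ∀ {c c' c''} (s : Side f₂ c) (s' : Side f₂ c') (s'' : Side f₂ c'') →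
                  Distinct (place s) (place s') (place s'') → TriangleOK (place s) (place s') (place s'')
  in-C-triangle s s' s'' (d₁ , d₂ , d₃) =
    Allowed-resp (≡-sym (place-rel s s' c≢c')) (≡-sym (place-rel s' s'' c'≢c''))
                 (≡-sym (place-rel s s'' c≢c''))
      (avoids-C _ _ _ (c≢c' , c'≢c'' , c≢c''))
    where
    c≢c'   = d₁ ∘ place-determined s s'
    c'≢c'' = d₂ ∘ place-determined s' s''
    c≢c''  = d₃ ∘ place-determined s s''

  new-old-new : ∀ a b c → ¬ InImage f₁ a → ¬ InImage f₂ c →
                TriangleOK (inj₁ a) (inj₁ (fun f₁ b)) (inj₂ c)
  new-old-new a b c na nc =
    Allowed-resp refl (≡-sym (trans (cross-old b c) (Str.sym C (fun f₂ b) c))) (≡-sym (cross-new a c na))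
      (view-allowed (compatibleA a na) (compatibleC c nc) (rule-view _ _) b)

  new-new-newC : ∀ a a' c → ¬ InImage f₁ a → ¬ InImage f₁ a' → ¬ InImage f₂ c → a ≢ a' →
                 TriangleOK (inj₁ a) (inj₁ a') (inj₂ c)
  new-new-newC a a' c na na' nc a≢a' =
    Allowed-resp refl (≡-sym (cross-new a' c na')) (≡-sym (cross-new a c na))
      (view-allowed₂ (compatibleA a na) (compatibleA a' na') (compatibleC c nc) in-A
        (rule-view _ _) (rule-view _ _))
    where
    in-A : ∀ b → Allowedₛ (rel A a a') (profileA a' b) (profileA a b)
    in-A b = avoids-A a a' (fun f₁ b)
               (a≢a' , (λ e → na' (b , ≡-sym e)) , (λ e → na (b , ≡-sym e)))

  -- A new point of A and two new points of C: the mirror image, via view-swap.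
  new-newC-newC : ∀ a c c' → ¬ InImage f₁ a → ¬ InImage f₂ c → ¬ InImage f₂ c' → c ≢ c' →
                  TriangleOK (inj₁ a) (inj₂ c) (inj₂ c')
  new-newC-newC a c c' na nc nc' c≢c' =
    Allowed-resp (≡-sym (cross-new a c na)) refl (≡-sym (cross-new a c' na))
      (allowed-swap₂₃ (allowed-swap₁₃
        (view-allowed₂ (compatibleC c nc) (compatibleC c' nc') (compatibleA a na) in-C
          (view-swap (rule-view _ _)) (view-swap (rule-view _ _)))))
    where
    in-C : ∀ b → Allowedₛ (rel C c c') (profileC c' b) (profileC c b)
    in-C b = avoids-C c c' (fun f₂ b)
               (c≢c' , (λ e → nc' (b , ≡-sym e)) , (λ e → nc (b , ≡-sym e)))

  two-in-A : ∀ {a a'} → Side f₁ a → Side f₁ a' → ∀ c → ¬ InImage f₂ c →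
             Distinct (inj₁ a) (inj₁ a') (inj₂ c) → TriangleOK (inj₁ a) (inj₁ a') (inj₂ c)
  two-in-A (old b)    (old b')     c nc d       = in-C-triangle (old b) (old b') (new c nc) d
  two-in-A (old b)    (new a' na') c nc d       = reorder₁₂ d λ _ → new-old-new a' b c na' nc
  two-in-A (new a na) (old b')     c nc _       = new-old-new a b' c na nc
  two-in-A (new a na) (new a' na') c nc (d , _) = new-new-newC a a' c na na' nc (d ∘ cong inj₁)

  one-in-A : ∀ {a} → Side f₁ a → ∀ c c' → ¬ InImage f₂ c → ¬ InImage f₂ c' →
             Distinct (inj₁ a) (inj₂ c) (inj₂ c') → TriangleOK (inj₁ a) (inj₂ c) (inj₂ c')
  one-in-A (old b)    c c' nc nc' d           = in-C-triangle (old b) (new c nc) (new c' nc') d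
  one-in-A (new a na) c c' nc nc' (_ , d , _) = new-newC-newC a c c' na nc nc' (d ∘ cong inj₂)

  triangle-ok : ∀ {x y z} → InD x → InD y → InD z → Distinct x y z → TriangleOK x y z
  triangle-ok {inj₁ a} {inj₁ a'} {inj₁ a''} _ _ _ d = in-A-triangle d
  triangle-ok {inj₂ c} {inj₂ c'} {inj₂ c''} nc nc' nc'' d =
    in-C-triangle (new c nc) (new c' nc') (new c'' nc'') d
  triangle-ok {inj₁ a} {inj₁ a'} {inj₂ c} _ _ nc d = two-in-A (side f₁ a) (side f₁ a') c nc d
  triangle-ok {inj₁ a} {inj₂ c} {inj₁ a'} _ nc _ d =
    reorder₂₃ d (two-in-A (side f₁ a) (side f₁ a') c nc)
  triangle-ok {inj₂ c} {inj₁ a} {inj₁ a'} nc _ _ d =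
    reorder₁₂ d λ d' → reorder₂₃ d' (two-in-A (side f₁ a) (side f₁ a') c nc)
  triangle-ok {inj₁ a} {inj₂ c} {inj₂ c'} _ nc nc' d = one-in-A (side f₁ a) c c' nc nc' d
  triangle-ok {inj₂ c} {inj₁ a} {inj₂ c'} nc _ nc' d =
    reorder₁₂ d (one-in-A (side f₁ a) c c' nc nc')
  triangle-ok {inj₂ c} {inj₂ c'} {inj₁ a} nc nc' _ d =
    reorder₂₃ d λ d' → reorder₁₂ d' (one-in-A (side f₁ a) c c' nc nc')

  in-D? : Decidable InD
  in-D? (inj₁ _) = yes tt
  in-D? (inj₂ c) = ¬? (any? λ b → fun f₂ b ≟ c)

  points : Enumeration InD
  points = enumerate-via (join (size A) (size C)) (splitAt (size A))
             (splitAt-join (size A) (size C)) (join-splitAt (size A) (size C)) in-D?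

  open Enumeration points

  D : Str
  D = record
    { size = count ; rel = λ i j → relP (elem i) (elem j) ; sym = λ i j → relP-sym (elem i) (elem j) }

  forbc-D : Forbc S D
  forbc-D = avoids⇒forbc D λ i j k d →
    triangle-ok (elem-sat i) (elem-sat j) (elem-sat k) (distinct-map elem-injective d)

  placeC : Fin (size C) → Point
  placeC c = place (side f₂ c)

  index-A : Fin (size A) → Fin count
  index-A a = index (inj₁ a) tt

  index-C : Fin (size C) → Fin count
  index-C c = index (placeC c) (place-in-D (side f₂ c))

  elem-index-A : ∀ a → elem (index-A a) ≡ inj₁ a
  elem-index-A a = elem-index (inj₁ a) tt

  elem-index-C : ∀ c → elem (index-C c) ≡ placeC c
  elem-index-C c = elem-index (placeC c) (place-in-D (side f₂ c))

  g₁ : Emb A D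
  g₁ = record
    { fun  = index-A
    ; inj  = λ a a' → inj₁-injective ∘ same-element (elem-index-A a) (elem-index-A a')
    ; pres = λ a a' _ → cong₂ relP (elem-index-A a) (elem-index-A a') }

  g₂ : Emb C D
  g₂ = record
    { fun  = index-C
    ; inj  = λ c c' → place-injective (side f₂ c) (side f₂ c')
                      ∘ same-element (elem-index-C c) (elem-index-C c')
    ; pres = λ c c' c≢c' → trans (cong₂ relP (elem-index-C c) (elem-index-C c'))
                                 (place-rel (side f₂ c) (side f₂ c') c≢c') }

  agree : ∀ b → index-A (fun f₁ b) ≡ index-C (fun f₂ b)
  agree b = same-index (elem-index-A (fun f₁ b))
              (trans (elem-index-C (fun f₂ b)) (place-determined (side f₂ (fun f₂ b)) (old b) refl))

  meet : ∀ a c → index-A a ≡ index-C c → Σ (Fin (size B)) λ b → index-A (fun f₁ b) ≡ index-A a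
  meet a c e =
    let (b , f₁b≡a) = place-in-A (side f₂ c) (same-element (elem-index-A a) (elem-index-C c) e)
    in b , cong index-A f₁b≡a

  new-edges : ∀ a c → ¬ InImage f₁ a → ¬ InImage f₂ c →
              RGY (rel D (fun g₁ a) (fun g₂ c)) ≡ true
  new-edges a c na nc = subst (λ ℓ → RGY ℓ ≡ true) (≡-sym new-edge) (view-RGY (rule-view _ _))
    where
    open ≡-Reasoning
    new-edge : rel D (fun g₁ a) (fun g₂ c) ≡ rule (profileA a) (profileC c)
    new-edge = begin
      rel D (index-A a) (index-C c)
        ≡⟨ cong₂ relP (elem-index-A a) (elem-index-C c) ⟩
      relP (inj₁ a) (placeC c)
        ≡⟨ cong (relP (inj₁ a)) (place-determined (side f₂ c) (new c nc) refl) ⟩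
      cross a c
        ≡⟨ cross-new a c na ⟩
      rule (profileA a) (profileC c)
        ∎

  amalgam : SemiFreeAmalgam (Forbc S) RGY f₁ f₂
  amalgam = D , forbc-D , g₁ , g₂ , agree , meet , new-edges

-- Existence: Forb_c(S) is semi-free with solutions {R, G, Y}; joint embedding
-- is amalgamation over the empty structure.
RGY-semi-free : IsSemiFree (Forbc S) RGY
RGY-semi-free = (X , refl) , amalgamation-class , λ A B C fA _ fC f₁ f₂ → Amalgam.amalgam fA fC f₁ f₂
  where
  amalgamation-class : IsAmalgamationClass (Forbc S)
  amalgamation-class = record
    { hereditary = λ A B → forbc-hereditary
    ; jep = λ A C fA fC →
        let (D , fD , g₁ , g₂ , _) = Amalgam.amalgam fA fC (∅-emb A) (∅-emb C) in D , fD , g₁ , g₂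
    ; ap  = λ A B C fA _ fC f₁ f₂ →
        let (D , fD , g₁ , g₂ , agree , _) = Amalgam.amalgam fA fC f₁ f₂ in D , fD , g₁ , g₂ , agree }

module Forcing {Ts : List Triangle} {L' : RelSet} (semi-free : IsSemiFree (Forbc Ts) L') where

  -- The label joining the
  -- two new points is a solution and completes each pair of edges (ℓA b, ℓC b)
  -- to an allowed triangle; if that pins the label down to m, m is a solution.
  forced : ∀ {m} B ℓA ℓC → Forbc Ts (extend B ℓA) → Forbc Ts B → Forbc Ts (extend B ℓC) →
           (∀ l → (∀ b → Allowed Ts (ℓA b) (ℓC b) l) → l ≡ m) → L' m ≡ true
  forced B ℓA ℓC fA fB fC unique
    with proj₂ (proj₂ semi-free) (extend B ℓA) B (extend B ℓC) fA fB fC extend-emb extend-emb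
  ... | D , fD , g₁ , g₂ , agree , meet , solutions =
    subst (λ l → L' l ≡ true) (unique _ closes) (solutions zero zero (new-point ℓA) (new-point ℓC))
    where
    new-point : ∀ ℓ → ¬ InImage (extend-emb {B} {ℓ}) zero
    new-point _ (_ , ())
    closes : ∀ b → Allowed Ts (ℓA b) (ℓC b) (rel D (fun g₁ zero) (fun g₂ zero))
    closes b = Allowed-resp (pres g₁ zero (suc b) λ ())
                 (trans (cong (λ i → rel D i (fun g₂ zero)) (agree b)) (pres g₂ (suc b) zero λ ())) refl
                 (forbc⇒avoids D fD _ _ _ (a≢b , b≢c , a≢c))
      where
      a≢b : fun g₁ zero ≢ fun g₁ (suc b)
      a≢b e with inj g₁ _ _ e
      ... | ()
      b≢c : fun g₁ (suc b) ≢ fun g₂ zero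
      b≢c e with inj g₂ _ _ (trans (≡-sym (agree b)) e)
      ... | ()
      a≢c : fun g₁ zero ≢ fun g₂ zero
      a≢c e with meet zero zero e
      ... | b' , e' with inj g₁ _ _ e'
      ... | ()

module Uniqueness (L' : RelSet) (semi-free : IsSemiFree (Forbc S) L') where
  open Forcing semi-free

  G-solution : L' G ≡ true
  G-solution = forced (edge R) (sides R R) (sides X Y)
    (triangle-forbc R R R (from-yes (allowed? R R R))) (edge-forbc R)
    (triangle-forbc R X Y (from-yes (allowed? X R Y)))
    λ l closes → only-G l (closes zero) (closes (suc zero))

  R-solution : L' R ≡ true
  R-solution = forced (edge R) (sides X G) (sides Y X)
    (triangle-forbc R X G (from-yes (allowed? X R G))) (edge-forbc R)
    (triangle-forbc R Y X (from-yes (allowed? Y R X)))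
    λ l closes → only-R l (closes zero) (closes (suc zero))

  Y-solution : L' Y ≡ true
  Y-solution = forced point (λ _ → X) (λ _ → X) (edge-forbc X) point-forbc (edge-forbc X)
    λ l closes → only-Y l (closes zero)

  -- Some label is not a solution, and R, G, Y all are, so it is X.
  X-not-solution : L' X ≡ false
  X-not-solution with proj₁ semi-free
  ... | X , X∉L' = X∉L'
  ... | R , R∉L' = contradiction (trans (≡-sym R-solution) R∉L') λ ()
  ... | G , G∉L' = contradiction (trans (≡-sym G-solution) G∉L') λ ()
  ... | Y , Y∉L' = contradiction (trans (≡-sym Y-solution) Y∉L') λ ()

  solutions-are-RGY : ∀ l → L' l ≡ RGY l
  solutions-are-RGY R = R-solution
  solutions-are-RGY G = G-solution
  solutions-are-RGY X = X-not-solution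
  solutions-are-RGY Y = Y-solution

lemma6p10 : IsSemiFree (Forbc S) RGY ×
    ((L' : RelSet) → IsSemiFree (Forbc S) L' → ∀ l → L' l ≡ RGY l)
lemma6p10 = RGY-semi-free , Uniqueness.solutions-are-RGY
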